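{- Let $L\ge2$ and $n\ge2$ be integers. For every integer $m$ with $L^{n-1}\le m\le\lfloor L^n/2\rfloor$, $\xi_m(K_L^n)\ge\xi_{L^{n-1}}(K_L^n)$.
   Context: $K_L^n$ is the graph on strings $x_n\cdots x_1$ over $\{0,\dots,L-1\}$, adjacent iff they differ in exactly one coordinate. For an integer $0\le m\le L^n$ with base-$L$ expansion $m=\sum_{i=0}^{s}a_iL^{b_i}$ ($a_i\in\{1,\dots,L-1\}$, $b_0>\dots>b_s\ge0$) let $ex_m(K_L^n)=\sum_{i=0}^{s}[(L-1)a_ib_iL^{b_i}+(a_i-1)a_iL^{b_i}]+2\sum_{i=0}^{s-1}\sum_{k=i+1}^{s}a_ia_kL^{b_k}$ ($ex_0=0$), and $\xi_m(K_L^n)=(L-1)nm-ex_m(K_L^n)$. -}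

module Defs where

open import Data.Nat using (ℕ; zero; suc; _+_; _*_; _∸_; _^_; _≤_)
open import Data.Nat.DivMod using (_/_; _%_)
open import Data.Integer using (ℤ; +_; _-_)
open import Data.List using (List; []; _∷_; reverse)
open import Data.Product using (_×_; _,_)

-- Little-endian base-L digits of m, tagged with their position j,
-- computed with a fuel bound (fuel = m suffices when L ≥ 2, since m < L^m).
taggedDigits : (L fuel pos m : ℕ) → List (ℕ × ℕ)
taggedDigits zero    _        _   _ = []
taggedDigits (suc k) zero     _   _ = []
taggedDigits (suc k) (suc f) pos m with m % suc k
... | zero  = taggedDigits (suc k) f (suc pos) (m / suc k)
... | suc d = (suc d , pos) ∷ taggedDigits (suc k) f (suc pos) (m / suc k)

-- Base-L expansion m = Σ_i a_i L^{b_i}, as the list of pairs (a_i , b_i)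
-- with a_i ∈ {1..L-1} and b_0 > b_1 > ... > b_s ≥ 0.
expansion : (L m : ℕ) → List (ℕ × ℕ)
expansion L m = reverse (taggedDigits L m 0 m)

value : ℕ → List (ℕ × ℕ) → ℕ
value L []             = 0
value L ((a , b) ∷ xs) = a * L ^ b + value L xs

-- ex over an expansion list (a_0,b_0),...,(a_s,b_s):
--   Σ_i [ (L-1) a_i b_i L^{b_i} + (a_i - 1) a_i L^{b_i} ]
--   + 2 Σ_{i<k} a_i a_k L^{b_k}
exList : ℕ → List (ℕ × ℕ) → ℕ
exList L []             = 0
exList L ((a , b) ∷ xs) =
  (L ∸ 1) * a * b * L ^ b + (a ∸ 1) * a * L ^ b
  + 2 * (a * value L xs) + exList L xs

-- ex_m(K_L^n)  (independent of n); ex_0 = 0 since the expansion of 0 is empty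
ex : (L m : ℕ) → ℕ
ex L m = exList L (expansion L m)

ξ : (L n m : ℕ) → ℤ
ξ L n m = + ((L ∸ 1) * n * m) - + ex L m

{-# OPTIONS --safe #-}
-- Write m = a L^{n-1} + V with leading digit 1 ≤ a ≤ L-1 and V < L^{n-1}. Expanding the
-- definition, ξ_m - (L-1)L^{n-1} = (L-1)(n-1)V - ex_V + (a-1)(L-1-a)L^{n-1} + (L-1-2a)V,
-- and ex_V ≤ (L-1)(n-1)V.  The hypothesis 2m ≤ L^n forces 2a ≤ L, and 2a = L only when
-- V = 0, so every term is nonnegative.  On the other hand ξ at L^{n-1} is (L-1)L^{n-1}.
module Submission where

open import Defs
open import Data.Nat using (ℕ; zero; suc; _+_; _*_; _∸_; _^_; _/_; _<_; _≤_; z≤n; s≤s)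
open import Data.Integer using () renaming (_≤_ to _≤ℤ_)
open import Data.Nat.Properties
open import Data.Nat.DivMod using (_%_; m≡m%n+[m/n]*n; m%n<n; m/n*n≤m; m<n*o⇒m/o<n)
open import Data.Nat.Tactic.RingSolver using (solve-∀; solve)
open import Data.List using (List; []; _∷_; reverse; _++_; [_])
open import Data.List.Properties using (unfold-reverse)
open import Data.Product using (_×_; _,_; ∃₂)
open import Data.Empty using (⊥-elim)
open import Relation.Nullary using (yes; no)
open import Algebra.Properties.CommutativeSemigroup +-commutativeSemigroup using (x∙yz≈y∙xz)
open import Relation.Binary.PropositionalEquality using (_≡_; refl; sym; trans; cong; subst; module ≡-Reasoning)
import Data.Integer as ℤ
import Data.Integer.Properties as ℤ

[+m]-[+n]≤+o : ∀ {m n o} → m ≤ n + o → ℤ.+ m ℤ.- ℤ.+ n ≤ℤ ℤ.+ o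
[+m]-[+n]≤+o {m} {n} {o} m≤n+o = begin
  ℤ.+ m ℤ.- ℤ.+ n  ≡⟨ ℤ.[+m]-[+n]≡m⊖n m n ⟩
  m ℤ.⊖ n          ≤⟨ ℤ.⊖-monoˡ-≤ n m≤n+o ⟩
  (n + o) ℤ.⊖ n    ≡⟨ ℤ.≤-⊖ (m≤m+n n o) ⟩
  ℤ.+ (n + o ∸ n)  ≡⟨ cong ℤ.+_ (m+n∸m≡n n o) ⟩
  ℤ.+ o            ∎
  where open ℤ.≤-Reasoning

+o≤[+m]-[+n] : ∀ {m n o} → o + n ≤ m → ℤ.+ o ≤ℤ ℤ.+ m ℤ.- ℤ.+ n
+o≤[+m]-[+n] {m} {n} {o} o+n≤m = begin
  ℤ.+ o            ≡⟨ cong ℤ.+_ (m+n∸n≡m o n) ⟨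
  ℤ.+ (o + n ∸ n)  ≡⟨ ℤ.⊖-≥ (m≤n+m n o) ⟨
  (o + n) ℤ.⊖ n    ≤⟨ ℤ.⊖-monoˡ-≤ n o+n≤m ⟩
  m ℤ.⊖ n          ≡⟨ ℤ.[+m]-[+n]≡m⊖n m n ⟨
  ℤ.+ m ℤ.- ℤ.+ n  ∎
  where open ℤ.≤-Reasoning

m<n^m : ∀ {n} m → 1 < n → m < n ^ m
m<n^m zero    _   = s≤s z≤n
m<n^m {n} (suc m) 1<n = ≤-<-trans (m<n^m m 1<n) (^-monoʳ-< n 1<n (n<1+n m))

m*n*o+m*o≡m*[1+n]*o : ∀ m n o → m * n * o + m * o ≡ m * suc n * o
m*n*o+m*o≡m*[1+n]*o = solve-∀

-- For V < L^b:  ex (a L^b + V) = (L-1) a b L^b + digitCost a (L^b) V + ex V.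
digitCost : ℕ → ℕ → ℕ → ℕ
digitCost a P V = (a ∸ 1) * a * P + 2 * (a * V)

digitCost≤ : ∀ {l a P V} → a ≤ l → V ≤ P → digitCost a P V ≤ l * (a * P + V)
digitCost≤ {a = zero}              _   _   = z≤n
digitCost≤ {l} {suc c} {P} {V} a≤l V≤P = begin
  c * suc c * P + 2 * (suc c * V)          ≡⟨ solve (c ∷ P ∷ V ∷ []) ⟩
  c * suc c * P + suc c * V + suc c * V  ≤⟨ +-monoʳ-≤ (c * suc c * P + suc c * V) (*-monoʳ-≤ (suc c) V≤P) ⟩
  c * suc c * P + suc c * V + suc c * P  ≡⟨ solve (c ∷ P ∷ V ∷ []) ⟩
  suc c * (suc c * P + V)                ≤⟨ *-monoˡ-≤ (suc c * P + V) a≤l ⟩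
  l * (suc c * P + V)                    ∎
  where open ≤-Reasoning

remainder≡0 : ∀ {a e P V} → e < a → 2 * (a * P + V) ≤ suc (a + e) * P → V ≡ 0
remainder≡0 {a} {e} {P} {V} e<a 2m≤[1+a+e]P = n≤0⇒n≡0 (≤-trans (m≤n*m V 2) 2V≤0)
  where
  1+a+e≤2a : suc (a + e) ≤ 2 * a
  1+a+e≤2a = begin
    suc (a + e)  ≡⟨ +-suc a e ⟨
    a + suc e    ≤⟨ +-monoʳ-≤ a e<a ⟩
    a + a        ≡⟨ cong (a +_) (+-identityʳ a) ⟨
    2 * a        ∎
    where open ≤-Reasoning
  2V≤0 : 2 * V ≤ 0
  2V≤0 = +-cancelˡ-≤ (2 * (a * P)) (2 * V) 0 (begin
    2 * (a * P) + 2 * V  ≡⟨ *-distribˡ-+ 2 (a * P) V ⟨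
    2 * (a * P + V)      ≤⟨ 2m≤[1+a+e]P ⟩
    suc (a + e) * P      ≤⟨ *-monoˡ-≤ P 1+a+e≤2a ⟩
    2 * a * P            ≡⟨ *-assoc 2 a P ⟩
    2 * (a * P)          ≡⟨ +-identityʳ (2 * (a * P)) ⟨
    2 * (a * P) + 0      ∎)
    where open ≤-Reasoning

leadingDigitCost≤ : ∀ {l a P V} → 1 ≤ a → a ≤ l → 2 * (a * P + V) ≤ suc l * P →
                    l * P + digitCost a P V ≤ l * (a * P + V)
leadingDigitCost≤ {l} {suc c} {P} {V} (s≤s z≤n) a≤l 2m≤[1+l]P with m≤n⇒∃[o]m+o≡n a≤l
... | e , refl = begin
  (suc c + e) * P + (c * suc c * P + 2 * (suc c * V))
    ≡⟨ solve (c ∷ e ∷ P ∷ V ∷ []) ⟩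
  suc c * P + c * suc c * P + suc c * V + (e * P + suc c * V)
    ≤⟨ +-monoʳ-≤ (suc c * P + c * suc c * P + suc c * V) surplus ⟩
  suc c * P + c * suc c * P + suc c * V + (e * suc c * P + e * V)
    ≡⟨ solve (c ∷ e ∷ P ∷ V ∷ []) ⟩
  (suc c + e) * (suc c * P + V)
    ∎
  where
  open ≤-Reasoning
  surplus : e * P + suc c * V ≤ e * suc c * P + e * V
  surplus with suc c ≤? e
  ... | yes a≤e = +-mono-≤ (*-monoˡ-≤ P (m≤m*n e (suc c))) (*-monoˡ-≤ V a≤e)
  ... | no  a≰e = +-mono-≤ (*-monoˡ-≤ P (m≤m*n e (suc c)))
    (subst (λ v → suc c * v ≤ e * v) (sym (remainder≡0 {P = P} (≰⇒> a≰e) 2m≤[1+l]P))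
      (≤-reflexive (trans (*-zeroʳ (suc c)) (sym (*-zeroʳ e)))))

data Digits (l : ℕ) : ℕ → ℕ → List (ℕ × ℕ) → Set where
  []   : ∀ {k p} → Digits l k p []
  cons : ∀ {k p a b xs} → a ≤ l → p ≤ b → b < k → Digits l b p xs → Digits l k p ((a , b) ∷ xs)

Digits-weaken : ∀ {l k k′ p p′ xs} → k ≤ k′ → p′ ≤ p → Digits l k p xs → Digits l k′ p′ xs
Digits-weaken k≤k′ p′≤p []                  = []
Digits-weaken k≤k′ p′≤p (cons a≤l p≤b b<k ds) =
  cons a≤l (≤-trans p′≤p p≤b) (≤-trans b<k k≤k′) (Digits-weaken ≤-refl p′≤p ds)

Digits-++ : ∀ {l k q p xs ys} → p ≤ q → q ≤ k →
            Digits l k q xs → Digits l q p ys → Digits l k p (xs ++ ys)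
Digits-++ p≤q q≤k []                    es = Digits-weaken q≤k ≤-refl es
Digits-++ p≤q q≤k (cons a≤l q≤b b<k ds) es = cons a≤l (≤-trans p≤q q≤b) b<k (Digits-++ p≤q q≤b ds es)

value-++ : ∀ L xs ys → value L (xs ++ ys) ≡ value L xs + value L ys
value-++ L []             ys = refl
value-++ L ((a , b) ∷ xs) ys = trans (cong (a * L ^ b +_) (value-++ L xs ys)) (sym (+-assoc (a * L ^ b) _ _))

module _ (l : ℕ) where

  private
    L = suc l

  value<L^k : ∀ {k p xs} → Digits l k p xs → value L xs < L ^ k
  value<L^k {k} []                                   = m^n>0 L k
  value<L^k {k} (cons {a = a} {b} {xs} a≤l _ b<k ds) = begin-strict
    a * L ^ b + value L xs  <⟨ +-monoʳ-< (a * L ^ b) (value<L^k ds) ⟩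
    a * L ^ b + L ^ b       ≡⟨ +-comm (a * L ^ b) (L ^ b) ⟩
    suc a * L ^ b           ≤⟨ *-monoˡ-≤ (L ^ b) (s≤s a≤l) ⟩
    L ^ suc b               ≤⟨ ^-monoʳ-≤ L b<k ⟩
    L ^ k                   ∎
    where open ≤-Reasoning

  taggedDigits-zero : ∀ fuel pos → taggedDigits L fuel pos 0 ≡ []
  taggedDigits-zero zero       pos = refl
  taggedDigits-zero (suc fuel) pos = taggedDigits-zero fuel (suc pos)

  m<L^[1+k]⇒m/L<L^k : ∀ {m} k → m < L ^ suc k → m / L < L ^ k
  m<L^[1+k]⇒m/L<L^k {m} k m<L^[1+k] = m<n*o⇒m/o<n (subst (m <_) (*-comm L (L ^ k)) m<L^[1+k])

  taggedDigits-Digits : ∀ fuel pos m k → m < L ^ k →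
                        Digits l (pos + k) pos (reverse (taggedDigits L fuel pos m))
  taggedDigits-Digits zero       pos m zero    _         = []
  taggedDigits-Digits zero       pos m (suc k) _         = []
  taggedDigits-Digits (suc fuel) pos m zero    (s≤s z≤n) rewrite taggedDigits-zero fuel (suc pos) = []
  taggedDigits-Digits (suc fuel) pos m (suc k) m<L^[1+k]
    with m % L | m%n<n m L | taggedDigits-Digits fuel (suc pos) (m / L) k (m<L^[1+k]⇒m/L<L^k k m<L^[1+k])
  ... | zero  | _       | higher rewrite +-suc pos k = Digits-weaken ≤-refl (n≤1+n pos) higher
  ... | suc d | s≤s d≤l | higher rewrite unfold-reverse (suc d , pos) (taggedDigits L fuel (suc pos) (m / L))
                                       | +-suc pos k =
    Digits-++ (n≤1+n pos) (m≤m+n (suc pos) k) higher (cons d≤l ≤-refl ≤-refl [])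

  value-taggedDigits : ∀ fuel pos m → m < L ^ fuel →
                       value L (reverse (taggedDigits L fuel pos m)) ≡ m * L ^ pos
  value-taggedDigits zero       pos zero    _           = refl
  value-taggedDigits zero       pos (suc m) (s≤s ())
  value-taggedDigits (suc fuel) pos m       m<L^[1+f]
    with m % L | m≡m%n+[m/n]*n m L | value-taggedDigits fuel (suc pos) (m / L) (m<L^[1+k]⇒m/L<L^k fuel m<L^[1+f])
  ... | zero  | m≡q*L | higher = begin
    value L (reverse (taggedDigits L fuel (suc pos) (m / L)))  ≡⟨ higher ⟩
    m / L * (L * L ^ pos)                                     ≡⟨ *-assoc (m / L) L (L ^ pos) ⟨
    m / L * L * L ^ pos                                       ≡⟨ cong (_* L ^ pos) m≡q*L ⟨
    m * L ^ pos                                               ∎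
    where open ≡-Reasoning
  ... | suc d | m≡d+q*L | higher = begin
    value L (reverse ((suc d , pos) ∷ taggedDigits L fuel (suc pos) (m / L)))
      ≡⟨ cong (value L) (unfold-reverse (suc d , pos) (taggedDigits L fuel (suc pos) (m / L))) ⟩
    value L (reverse (taggedDigits L fuel (suc pos) (m / L)) ++ [ (suc d , pos) ])
      ≡⟨ value-++ L (reverse (taggedDigits L fuel (suc pos) (m / L))) [ (suc d , pos) ] ⟩
    value L (reverse (taggedDigits L fuel (suc pos) (m / L))) + (suc d * L ^ pos + 0)
      ≡⟨ cong (_+ (suc d * L ^ pos + 0)) higher ⟩
    m / L * (L * L ^ pos) + (suc d * L ^ pos + 0)
      ≡⟨ recombine (m / L) L (L ^ pos) (suc d) ⟩
    (suc d + m / L * L) * L ^ pos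
      ≡⟨ cong (_* L ^ pos) m≡d+q*L ⟨
    m * L ^ pos
      ∎
    where
    open ≡-Reasoning
    recombine : ∀ q b P d → q * (b * P) + (d * P + 0) ≡ (d + q * b) * P
    recombine = solve-∀

  exList-cons≤ : ∀ {a b xs} → exList L xs ≤ l * b * value L xs →
                 exList L ((a , b) ∷ xs) ≤ l * b * value L ((a , b) ∷ xs) + digitCost a (L ^ b) (value L xs)
  exList-cons≤ {a} {b} {xs} ex≤ = begin
    l * a * b * L ^ b + (a ∸ 1) * a * L ^ b + 2 * (a * value L xs) + exList L xs
      ≤⟨ +-monoʳ-≤ (l * a * b * L ^ b + (a ∸ 1) * a * L ^ b + 2 * (a * value L xs)) ex≤ ⟩
    l * a * b * L ^ b + (a ∸ 1) * a * L ^ b + 2 * (a * value L xs) + l * b * value L xs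
      ≡⟨ regroup l a b (L ^ b) (value L xs) (a ∸ 1) ⟩
    l * b * (a * L ^ b + value L xs) + digitCost a (L ^ b) (value L xs)
      ∎
    where
    open ≤-Reasoning
    regroup : ∀ l a b P V d →
              l * a * b * P + d * a * P + 2 * (a * V) + l * b * V ≡ l * b * (a * P + V) + (d * a * P + 2 * (a * V))
    regroup = solve-∀

  exList≤ : ∀ {k p xs} → Digits l k p xs → exList L xs ≤ l * k * value L xs
  exList≤ []                                               = z≤n
  exList≤ {k} (cons {a = a} {b} {xs} a≤l _ b<k ds) = begin
    exList L ((a , b) ∷ xs)                      ≤⟨ exList-cons≤ {a} {b} {xs} (exList≤ ds) ⟩
    l * b * v + digitCost a (L ^ b) (value L xs)  ≤⟨ +-monoʳ-≤ (l * b * v) (digitCost≤ a≤l (<⇒≤ (value<L^k ds))) ⟩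
    l * b * v + l * v                            ≡⟨ m*n*o+m*o≡m*[1+n]*o l b v ⟩
    l * suc b * v                                ≤⟨ *-monoˡ-≤ v (*-monoʳ-≤ l b<k) ⟩
    l * k * v                                    ∎
    where
    open ≤-Reasoning
    v = value L ((a , b) ∷ xs)

  expansion-Digits : ∀ {m k} → m < L ^ k → Digits l k 0 (expansion L m)
  expansion-Digits {m} {k} = taggedDigits-Digits m 0 m k

  value-expansion : 1 ≤ l → ∀ m → value L (expansion L m) ≡ m
  value-expansion 1≤l m = trans (value-taggedDigits m 0 m (m<n^m m (s≤s 1≤l))) (*-identityʳ m)

  leading-digit : ∀ {n xs} → Digits l (suc n) 0 xs → L ^ n ≤ value L xs →
                  ∃₂ λ c rest → xs ≡ (suc c , n) ∷ rest × suc c ≤ l × Digits l n 0 rest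
  leading-digit {n} [] Lⁿ≤0 = ⊥-elim (<⇒≱ (m^n>0 L n) Lⁿ≤0)
  leading-digit {n} (cons {a = a} {b} {rest} a≤l _ (s≤s b≤n) ds) Lⁿ≤v with b <? n
  ... | yes b<n = ⊥-elim (<⇒≱ (<-≤-trans (value<L^k (cons a≤l z≤n ≤-refl ds)) (^-monoʳ-≤ L b<n)) Lⁿ≤v)
  ... | no b≮n with ≤-antisym b≤n (≮⇒≥ b≮n) | a
  ...   | refl | zero  = ⊥-elim (<⇒≱ (value<L^k ds) Lⁿ≤v)
  ...   | refl | suc c = c , rest , refl , a≤l , ds

  exList-leading≥ : ∀ {n xs} → Digits l (suc n) 0 xs → value L xs ≡ L ^ n → l * n * L ^ n ≤ exList L xs
  exList-leading≥ {n} ds v≡Lⁿ with leading-digit ds (≤-reflexive (sym v≡Lⁿ))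
  ... | c , rest , refl , _ , _ = begin
    l * n * L ^ n                                            ≤⟨ *-monoˡ-≤ (L ^ n) (*-monoˡ-≤ n (m≤m*n l (suc c))) ⟩
    l * suc c * n * L ^ n                                    ≤⟨ m≤m+n _ _ ⟩
    l * suc c * n * L ^ n + c * suc c * L ^ n                ≤⟨ m≤m+n _ _ ⟩
    l * suc c * n * L ^ n + c * suc c * L ^ n + 2 * (suc c * value L rest)
                                                             ≤⟨ m≤m+n _ _ ⟩
    exList L ((suc c , n) ∷ rest)                            ∎
    where open ≤-Reasoning

  exList-leading≤ : ∀ {n m xs} → Digits l (suc n) 0 xs → value L xs ≡ m → L ^ n ≤ m → 2 * m ≤ L ^ suc n →
                    l * L ^ n + exList L xs ≤ l * suc n * m
  exList-leading≤ {n} ds refl Lⁿ≤m 2m≤Lⁿ⁺¹ with leading-digit ds Lⁿ≤m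
  ... | c , rest , refl , a≤l , ds′ = begin
    l * L ^ n + exList L xs                        ≤⟨ +-monoʳ-≤ (l * L ^ n) (exList-cons≤ {suc c} {n} {rest} (exList≤ ds′)) ⟩
    l * L ^ n + (l * n * m + digitCost (suc c) (L ^ n) (value L rest))
                                                   ≡⟨ x∙yz≈y∙xz (l * L ^ n) (l * n * m) _ ⟩
    l * n * m + (l * L ^ n + digitCost (suc c) (L ^ n) (value L rest))
                                                   ≤⟨ +-monoʳ-≤ (l * n * m) (leadingDigitCost≤ (s≤s z≤n) a≤l 2m≤Lⁿ⁺¹) ⟩
    l * n * m + l * m                              ≡⟨ m*n*o+m*o≡m*[1+n]*o l n m ⟩
    l * suc n * m                                  ∎
    where
    open ≤-Reasoning
    xs = (suc c , n) ∷ rest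
    m = value L xs

  ex-power≥ : 1 ≤ l → ∀ n → l * n * L ^ n ≤ ex L (L ^ n)
  ex-power≥ 1≤l n = exList-leading≥ (expansion-Digits (^-monoʳ-< L (s≤s 1≤l) (n<1+n n))) (value-expansion 1≤l (L ^ n))

  ex≤ : 1 ≤ l → ∀ {n m} → L ^ n ≤ m → 2 * m ≤ L ^ suc n → l * L ^ n + ex L m ≤ l * suc n * m
  ex≤ 1≤l {n} {m} Lⁿ≤m 2m≤Lⁿ⁺¹ = exList-leading≤ (expansion-Digits m<Lⁿ⁺¹) (value-expansion 1≤l m) Lⁿ≤m 2m≤Lⁿ⁺¹
    where
    m<2m : m < 2 * m
    m<2m = m<m+n m (≤-trans (m^n>0 L n) (≤-trans Lⁿ≤m (≤-reflexive (sym (+-identityʳ m)))))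
    m<Lⁿ⁺¹ : m < L ^ suc n
    m<Lⁿ⁺¹ = <-≤-trans m<2m 2m≤Lⁿ⁺¹

  ξ-power≤ : 1 ≤ l → ∀ n → ξ L (suc n) (L ^ n) ≤ℤ ℤ.+ (l * L ^ n)
  ξ-power≤ 1≤l n = [+m]-[+n]≤+o (begin
    l * suc n * L ^ n          ≡⟨ m*n*o+m*o≡m*[1+n]*o l n (L ^ n) ⟨
    l * n * L ^ n + l * L ^ n  ≤⟨ +-monoˡ-≤ (l * L ^ n) (ex-power≥ 1≤l n) ⟩
    ex L (L ^ n) + l * L ^ n   ∎)
    where open ≤-Reasoning

  ξ≥ : 1 ≤ l → ∀ {n m} → L ^ n ≤ m → 2 * m ≤ L ^ suc n → ℤ.+ (l * L ^ n) ≤ℤ ξ L (suc n) m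
  ξ≥ 1≤l Lⁿ≤m 2m≤Lⁿ⁺¹ = +o≤[+m]-[+n] (ex≤ 1≤l Lⁿ≤m 2m≤Lⁿ⁺¹)

mainTheorem7 : (L n : ℕ) → 2 ≤ L → 2 ≤ n →
    (m : ℕ) → L ^ (n ∸ 1) ≤ m → m ≤ (L ^ n) / 2 →
    ξ L n (L ^ (n ∸ 1)) ≤ℤ ξ L n m
mainTheorem7 (suc l) (suc n) (s≤s 1≤l) (s≤s _) m Lⁿ≤m m≤Lⁿ⁺¹/2 =
  ℤ.≤-trans (ξ-power≤ l 1≤l n) (ξ≥ l 1≤l Lⁿ≤m 2m≤Lⁿ⁺¹)
  where
  Lⁿ⁺¹ = suc l ^ suc n
  2m≤Lⁿ⁺¹ : 2 * m ≤ Lⁿ⁺¹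
  2m≤Lⁿ⁺¹ = ≤-trans (*-monoʳ-≤ 2 m≤Lⁿ⁺¹/2) (subst (_≤ Lⁿ⁺¹) (*-comm (Lⁿ⁺¹ / 2) 2) (m/n*n≤m Lⁿ⁺¹ 2))
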